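{- Let $H$ be a graph and $w$ a vertex of $H$ of degree at least $2$. Let $u_1,u_2,\ldots,u_k$ be all the neighbors of $w$. Then the graph $H'=H-\{wu_i: i\in\{1,2,\ldots,k-1\}\}$ (obtained by deleting the edges $wu_1,\dots,wu_{k-1}$) satisfies $i(H)\le i(H')$.
   Context: All graphs are finite and simple. An independent dominating set of a graph is a set $S$ of pairwise non-adjacent vertices such that every vertex not in $S$ has a neighbor in $S$; $i(G)$ denotes the minimum size of an independent dominating set of $G$. -}

module Defs where

open import Data.Nat using (ℕ; _≤_)
open import Data.Bool using (Bool; true; false; _∧_; _∨_; not)
open import Data.Bool.Properties using (∨-comm)
open import Data.Fin using (Fin; _≟_)
open import Data.Fin.Subset using (Subset; _∈_; _∉_; ∣_∣)
open import Data.Vec using (tabulate)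
open import Data.Product using (Σ; _×_; ∃; _,_)
open import Relation.Nullary.Decidable using (⌊_⌋)
open import Relation.Binary.PropositionalEquality using (_≡_; refl; cong₂)

record Graph (n : ℕ) : Set where
  field
    adj   : Fin n → Fin n → Bool
    sym   : ∀ x y → adj x y ≡ adj y x
    irref : ∀ x → adj x x ≡ false
open Graph public

N : ∀ {n} → Graph n → Fin n → Subset n
N G w = tabulate (adj G w)

deg : ∀ {n} → Graph n → Fin n → ℕ
deg G w = ∣ N G w ∣

Independent : ∀ {n} → Graph n → Subset n → Set
Independent G S = ∀ x y → x ∈ S → y ∈ S → adj G x y ≡ false

Dominating : ∀ {n} → Graph n → Subset n → Set
Dominating G S = ∀ x → x ∉ S → Σ _ λ y → y ∈ S × adj G x y ≡ true

IsIDS : ∀ {n} → Graph n → Subset n → Set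
IsIDS G S = Independent G S × Dominating G S

IsIndDomNumber : ∀ {n} → Graph n → ℕ → Set
IsIndDomNumber G k =
  (Σ _ λ S → IsIDS G S × ∣ S ∣ ≡ k) × (∀ S → IsIDS G S → k ≤ ∣ S ∣)

-- Edge deletion: from G remove every edge w u with u ≠ v
-- (i.e. all edges at w except the edge w v).
private
  removed : ∀ {n} → Fin n → Fin n → Fin n → Fin n → Bool
  removed w v x y =
    (⌊ x ≟ w ⌋ ∧ not ⌊ y ≟ v ⌋) ∨ (⌊ y ≟ w ⌋ ∧ not ⌊ x ≟ v ⌋)

  removed-sym : ∀ {n} (w v x y : Fin n) → removed w v x y ≡ removed w v y x
  removed-sym w v x y = ∨-comm (⌊ x ≟ w ⌋ ∧ not ⌊ y ≟ v ⌋) (⌊ y ≟ w ⌋ ∧ not ⌊ x ≟ v ⌋)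

deleteAllBut : ∀ {n} → Graph n → (w v : Fin n) → Graph n
deleteAllBut G w v = record
  { adj   = λ x y → adj G x y ∧ not (removed w v x y)
  ; sym   = λ x y → cong₂ (λ a b → a ∧ not b) (sym G x y) (removed-sym w v x y)
  ; irref = λ x → cong₂ (λ a b → a ∧ not b) (irref G x) refl
  }

{-# OPTIONS --safe #-}
-- Let S be an independent dominating set of H'. Away from w nothing changed, and in H' the
-- only neighbour of w is u = uₖ. If w ∉ S, or w has no H-neighbour in S, then S is already an
-- independent dominating set of H. Otherwise remove w from S: the only vertices that may
-- lose their dominator are w, which is dominated by its H-neighbour in S - w, and u, whose
-- dominator in H' might have been w. If u has no H-neighbour in S - w, add u in place of w;
-- it is independent from S - w and dominates w.
module Submission where

open import Defs
open import Data.Nat using (ℕ; _≤_; _+_; suc; s≤s; z≤n)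
open import Data.Nat.Properties using (≤-refl; ≤-trans; ≤-reflexive; +-monoʳ-≤; +-suc; +-comm; n≤1+n)
open import Data.Bool using (true; false; _∧_; _∨_; not)
import Data.Bool.Properties as Bool
open import Data.Fin using (Fin; _≟_)
open import Data.Fin.Subset using (Subset; _∈_; _∉_; _⊆_; ∣_∣; _∪_; _─_; _-_; ⁅_⁆)
open import Data.Fin.Subset.Properties
  using (_∈?_; x∈⁅x⁆; x∈⁅y⁆⇒x≡y; ∣⁅x⁆∣≡1; x∈p∪q⁺; x∈p∪q⁻; p⊆p∪q; p─q⊆p; ∣p─q∣≤∣p∣;
         x∈p∧x≢y⇒x∈p-y; x∈p⇒∣p-x∣<∣p∣)
open import Data.Fin.Properties using (any?)
open import Data.Vec using (_∷_; [])
open import Data.Vec.Base using (here; there)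
open import Data.Product using (Σ; _×_; _,_)
open import Data.Sum using (inj₁; inj₂)
open import Data.Empty using (⊥-elim)
open import Function using (id; const)
open import Relation.Nullary using (¬_; Dec; yes; no)
open import Relation.Nullary.Decidable using (⌊_⌋; _×-dec_)
open import Relation.Binary.PropositionalEquality using (_≡_; _≢_; refl; trans; cong; subst)
  renaming (sym to ≡-sym)

private
  variable
    n : ℕ

∣p∪q∣≤∣p∣+∣q∣ : (p q : Subset n) → ∣ p ∪ q ∣ ≤ ∣ p ∣ + ∣ q ∣
∣p∪q∣≤∣p∣+∣q∣ []          []          = z≤n
∣p∪q∣≤∣p∣+∣q∣ (true ∷ p)  (true ∷ q)  = s≤s (≤-trans (∣p∪q∣≤∣p∣+∣q∣ p q) (+-monoʳ-≤ ∣ p ∣ (n≤1+n _)))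
∣p∪q∣≤∣p∣+∣q∣ (true ∷ p)  (false ∷ q) = s≤s (∣p∪q∣≤∣p∣+∣q∣ p q)
∣p∪q∣≤∣p∣+∣q∣ (false ∷ p) (true ∷ q)  rewrite +-suc ∣ p ∣ ∣ q ∣ = s≤s (∣p∪q∣≤∣p∣+∣q∣ p q)
∣p∪q∣≤∣p∣+∣q∣ (false ∷ p) (false ∷ q) = ∣p∪q∣≤∣p∣+∣q∣ p q

∣p-x∪⁅y⁆∣≤∣p∣ : ∀ {p : Subset n} {x} y → x ∈ p → ∣ (p - x) ∪ ⁅ y ⁆ ∣ ≤ ∣ p ∣
∣p-x∪⁅y⁆∣≤∣p∣ {p = p} {x} y x∈p =
  ≤-trans (∣p∪q∣≤∣p∣+∣q∣ (p - x) ⁅ y ⁆) (subst (_≤ ∣ p ∣) size (x∈p⇒∣p-x∣<∣p∣ x∈p))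
  where
  size : suc ∣ p - x ∣ ≡ ∣ p - x ∣ + ∣ ⁅ y ⁆ ∣
  size = trans (+-comm 1 ∣ p - x ∣) (cong (∣ p - x ∣ +_) (≡-sym (∣⁅x⁆∣≡1 y)))

x∈p─q⇒x∉q : ∀ {x : Fin n} (p q : Subset n) → x ∈ p ─ q → x ∉ q
x∈p─q⇒x∉q (true ∷ p) (false ∷ q) here      ()
x∈p─q⇒x∉q (_ ∷ p)    (_ ∷ q)     (there x∈) (there x∈q) = x∈p─q⇒x∉q p q x∈ x∈q

x∈p-y⇒x≢y : ∀ {x y : Fin n} (p : Subset n) → x ∈ p - y → x ≢ y
x∈p-y⇒x≢y {y = y} p x∈ refl = x∈p─q⇒x∉q p ⁅ y ⁆ x∈ (x∈⁅x⁆ y)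

x∈p-y⇒x∈p : ∀ {x y : Fin n} (p : Subset n) → x ∈ p - y → x ∈ p
x∈p-y⇒x∈p {y = y} p = p─q⊆p p ⁅ y ⁆

x∉p⇒p⊆p-x : ∀ {p : Subset n} {x} → x ∉ p → p ⊆ p - x
x∉p⇒p⊆p-x x∉p y∈p = x∈p∧x≢y⇒x∈p-y y∈p λ { refl → x∉p y∈p }

p⊆p-x∪⁅x⁆ : ∀ (p : Subset n) x → p ⊆ (p - x) ∪ ⁅ x ⁆
p⊆p-x∪⁅x⁆ p x {y} y∈p with y ≟ x
... | yes refl = x∈p∪q⁺ (inj₂ (x∈⁅x⁆ x))
... | no  y≢x  = x∈p∪q⁺ (inj₁ (x∈p∧x≢y⇒x∈p-y y∈p y≢x))

HasNeighbourIn : Graph n → Fin n → Subset n → Set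
HasNeighbourIn G v S = Σ _ λ y → y ∈ S × adj G v y ≡ true

hasNeighbourIn? : (G : Graph n) (v : Fin n) (S : Subset n) → Dec (HasNeighbourIn G v S)
hasNeighbourIn? G v S = any? λ y → (y ∈? S) ×-dec (adj G v y Bool.≟ true)

¬HasNeighbourIn⇒¬adj : ∀ {G : Graph n} {v y S} → ¬ HasNeighbourIn G v S → y ∈ S → adj G v y ≡ false
¬HasNeighbourIn⇒¬adj {G = G} {v} {y} v↛ y∈S with adj G v y in eq
... | true  = ⊥-elim (v↛ (y , y∈S , eq))
... | false = refl

independent-⊆ : ∀ {G : Graph n} {P Q} → P ⊆ Q → Independent G Q → Independent G P
independent-⊆ P⊆Q indQ x y x∈P y∈P = indQ x y (P⊆Q x∈P) (P⊆Q y∈P)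

independent-∪⁅⁆ : ∀ {G : Graph n} {P v} → Independent G P → ¬ HasNeighbourIn G v P → Independent G (P ∪ ⁅ v ⁆)
independent-∪⁅⁆ {G = G} {P} {v} indP v↛ x y x∈ y∈ with x∈p∪q⁻ P ⁅ v ⁆ x∈ | x∈p∪q⁻ P ⁅ v ⁆ y∈
... | inj₁ x∈P | inj₁ y∈P = indP x y x∈P y∈P
... | inj₁ x∈P | inj₂ y∈v rewrite x∈⁅y⁆⇒x≡y v y∈v = trans (sym G x v) (¬HasNeighbourIn⇒¬adj {G = G} v↛ x∈P)
... | inj₂ x∈v | inj₁ y∈P rewrite x∈⁅y⁆⇒x≡y v x∈v = ¬HasNeighbourIn⇒¬adj {G = G} v↛ y∈P
... | inj₂ x∈v | inj₂ y∈v rewrite x∈⁅y⁆⇒x≡y v x∈v | x∈⁅y⁆⇒x≡y v y∈v = irref G v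

dominating-mono : ∀ {G G' : Graph n} {S} →
                  (∀ {x y} → adj G x y ≡ true → adj G' x y ≡ true) → Dominating G S → Dominating G' S
dominating-mono G⊆G' domS v v∉S with domS v v∉S
... | y , y∈S , vy = y , y∈S , G⊆G' vy

indDomNumber-mono : ∀ {G G' : Graph n} {a b} →
                    (∀ S → IsIDS G' S → Σ _ λ T → IsIDS G T × ∣ T ∣ ≤ ∣ S ∣) →
                    IsIndDomNumber G a → IsIndDomNumber G' b → a ≤ b
indDomNumber-mono shrink (_ , minimalG) ((S , idsS , ∣S∣≡b) , _) with shrink S idsS
... | T , idsT , ∣T∣≤∣S∣ = ≤-trans (minimalG T idsT) (≤-trans ∣T∣≤∣S∣ (≤-reflexive ∣S∣≡b))

module _ (H : Graph n) (w u : Fin n) where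

  private
    H' : Graph n
    H' = deleteAllBut H w u

  deleteAllBut-⊆ : ∀ {x y} → adj H' x y ≡ true → adj H x y ≡ true
  deleteAllBut-⊆ {x} {y} with adj H x y
  ... | true  = const refl
  ... | false = id

  deleteAllBut-≢ : ∀ {x y} → x ≢ w → y ≢ w → adj H' x y ≡ adj H x y
  deleteAllBut-≢ {x} {y} x≢w y≢w with x ≟ w | y ≟ w
  ... | yes x≡w | _       = ⊥-elim (x≢w x≡w)
  ... | no _    | yes y≡w = ⊥-elim (y≢w y≡w)
  ... | no _    | no _    = Bool.∧-identityʳ (adj H x y)

  deleteAllBut-adj-w⇒≡u : ∀ {x} → adj H' x w ≡ true → x ≡ u
  deleteAllBut-adj-w⇒≡u {x} xw with x ≟ u | w ≟ w
  ... | yes x≡u | _      = x≡u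
  ... | no _    | no w≢w = ⊥-elim (w≢w refl)
  ... | no _    | yes _  = ⊥-elim (edge-removed (adj H x w) (⌊ x ≟ w ⌋ ∧ not ⌊ w ≟ u ⌋) xw)
    where
    edge-removed : ∀ a b → a ∧ not (b ∨ true) ≢ true
    edge-removed false _     ()
    edge-removed true  false ()
    edge-removed true  true  ()

  deleteAllBut-adj⇒≢w : ∀ {x y} → x ≢ u → adj H' x y ≡ true → y ≢ w
  deleteAllBut-adj⇒≢w x≢u xy refl = x≢u (deleteAllBut-adj-w⇒≡u xy)

  independent-deleteAllBut : ∀ S → Independent H' S → Independent H (S - w)
  independent-deleteAllBut S indS x y x∈ y∈ =
    trans (≡-sym (deleteAllBut-≢ (x∈p-y⇒x≢y S x∈) (x∈p-y⇒x≢y S y∈)))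
          (indS x y (x∈p-y⇒x∈p S x∈) (x∈p-y⇒x∈p S y∈))

  dominating-deleteAllBut : ∀ S {T} → Dominating H' S → S - w ⊆ T →
                            (w ∉ T → HasNeighbourIn H w T) → (u ∉ T → HasNeighbourIn H u T) →
                            Dominating H T
  dominating-deleteAllBut S {T} domS S-w⊆T w↦T u↦T v v∉T with v ≟ w | v ≟ u
  ... | yes refl | _        = w↦T v∉T
  ... | no _     | yes refl = u↦T v∉T
  ... | no v≢w   | no v≢u with v ∈? S
  ...   | yes v∈S = ⊥-elim (v∉T (S-w⊆T (x∈p∧x≢y⇒x∈p-y v∈S v≢w)))
  ...   | no v∉S with domS v v∉S
  ...     | y , y∈S , vy = y , S-w⊆T (x∈p∧x≢y⇒x∈p-y y∈S (deleteAllBut-adj⇒≢w v≢u vy)) , deleteAllBut-⊆ vy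

  ids-deleteAllBut-shrink : adj H w u ≡ true → ∀ S → IsIDS H' S → Σ _ λ T → IsIDS H T × ∣ T ∣ ≤ ∣ S ∣
  ids-deleteAllBut-shrink wu S (indS , domS) with w ∈? S
  ... | no w∉S =
    S , (independent-⊆ {G = H} (x∉p⇒p⊆p-x w∉S) (independent-deleteAllBut S indS) ,
         dominating-mono {G = H'} {G' = H} deleteAllBut-⊆ domS) ,
    ≤-refl
  ... | yes w∈S with hasNeighbourIn? H u (S - w) | hasNeighbourIn? H w (S - w)
  ...   | no u↛ | _ =
    (S - w) ∪ ⁅ u ⁆ ,
    (independent-∪⁅⁆ {G = H} (independent-deleteAllBut S indS) u↛ ,
     dominating-deleteAllBut S domS (p⊆p∪q ⁅ u ⁆) (const (u , u∈T , wu)) (λ u∉T → ⊥-elim (u∉T u∈T))) ,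
    ∣p-x∪⁅y⁆∣≤∣p∣ u w∈S
    where
    u∈T : u ∈ (S - w) ∪ ⁅ u ⁆
    u∈T = x∈p∪q⁺ (inj₂ (x∈⁅x⁆ u))
  ...   | yes u↦ | yes w↦ =
    S - w , (independent-deleteAllBut S indS , dominating-deleteAllBut S domS id (const w↦) (const u↦)) ,
    ∣p─q∣≤∣p∣ S ⁅ w ⁆
  ...   | yes _  | no w↛ =
    S , (independent-⊆ {G = H} (p⊆p-x∪⁅x⁆ S w)
                        (independent-∪⁅⁆ {G = H} (independent-deleteAllBut S indS) w↛) ,
         dominating-mono {G = H'} {G' = H} deleteAllBut-⊆ domS) ,
    ≤-refl

lemma2p1 : ∀ {n} (H : Graph n) (w uₖ : Fin n) → 2 ≤ deg H w
           → adj H w uₖ ≡ true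
           → ∀ (a b : ℕ) → IsIndDomNumber H a
           → IsIndDomNumber (deleteAllBut H w uₖ) b → a ≤ b
lemma2p1 H w uₖ _ wuₖ _ _ =
  indDomNumber-mono {G = H} {G' = deleteAllBut H w uₖ} (ids-deleteAllBut-shrink H w uₖ wuₖ)
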